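{- Let $G$ be a graph with $N$ vertices and let $d,n,r$ be positive integers with $d\le n$. Call a sequence $S$ of $k$ vertices of $G$ rare if $|N(S)| \leq (2n)^{ -2n} t_{K_{r,d}}(G)^{\frac{k}{rd}} N$. Call a sequence $T=(v_1,\ldots,v_r)$ of $r$ vertices of $G$ bad with respect to $k$ if the number of rare sequences of $k$ vertices all lying in $N(T)$ is at least $\frac{1}{2n}|N(T)|^k$. Call $T$ good if for every $k$ with $d\le k\le n$, $T$ is not bad with respect to $k$. Then $$\sum_{T \text{ good}} |N(T)|^d \geq \tfrac{1}{2} h_{K_{r,d}}(G),$$ where the sum is over all good sequences $T$ of $r$ vertices.
   Context: All graphs are finite. Sequences of vertices may contain repeated vertices. For a sequence $S$ of vertices of $G$, the common neighborhood $N(S)$ is the set of vertices adjacent to every vertex of $S$. A homomorphism from $F$ to $G$ is a map $V(F)\to V(G)$ sending edges to edges; $h_F(G)$ is the number of homomorphisms and $t_F(G)=h_F(G)/|V(G)|^{|V(F)|}$. $K_{r,d}$ is the complete bipartite graph with parts of sizes $r$ and $d$. -}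

module Defs where

open import Data.Bool using (Bool; true; false; _∧_; _∨_; not; _xor_; if_then_else_)
open import Data.Nat using (ℕ; zero; suc; _+_; _*_; _^_; _≤ᵇ_)
open import Data.Fin using (Fin; splitAt)
open import Data.Sum using (inj₁; inj₂)
open import Data.List using (List; []; _∷_; map; concatMap; filter; length; allFin; upTo)
open import Data.Bool.ListAction using (and)
open import Data.Nat.ListAction using (sum)
open import Data.Vec using (Vec; []; _∷_; lookup)
open import Relation.Binary.PropositionalEquality using (_≡_; refl)

all : {A : Set} → (A → Bool) → List A → Bool
all p xs = and (map p xs)

record Graph (N : ℕ) : Set where
  field
    adj    : Fin N → Fin N → Bool
    sym    : ∀ u v → adj u v ≡ adj v u
    irrefl : ∀ v → adj v v ≡ false
open Graph public

count : {A : Set} → (A → Bool) → List A → ℕ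
count p xs = length (filter (λ x → Data.Bool.T? (p x)) xs)
  where import Data.Bool

seqs : {A : Set} → List A → (k : ℕ) → List (Vec A k)
seqs xs zero    = [] ∷ []
seqs xs (suc k) = concatMap (λ x → map (x ∷_) (seqs xs k)) xs

adjAll : {N k : ℕ} → Graph N → Vec (Fin N) k → Fin N → Bool
adjAll G []      v = true
adjAll G (s ∷ S) v = adj G s v ∧ adjAll G S v

nbhd : {N k : ℕ} → Graph N → Vec (Fin N) k → List (Fin N)
nbhd {N} G S = filter (λ v → Data.Bool.T? (adjAll G S v)) (allFin N)
  where import Data.Bool

nbhdSize : {N k : ℕ} → Graph N → Vec (Fin N) k → ℕ
nbhdSize G S = length (nbhd G S)

isHom : {m N : ℕ} → Graph m → Graph N → Vec (Fin N) m → Bool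
isHom {m} F G f =
  all (λ i → all (λ j → not (adj F i j) ∨ adj G (lookup f i) (lookup f j)) (allFin m)) (allFin m)

homCount : {m N : ℕ} → Graph m → Graph N → ℕ
homCount {m} {N} F G = count (isHom F G) (seqs (allFin N) m)

-- the complete bipartite graph K_{r,d} on Fin (r + d): parts are the first
-- r vertices and the last d vertices
inLeft : (r : ℕ) {d : ℕ} → Fin (r + d) → Bool
inLeft r i with splitAt r i
... | inj₁ _ = true
... | inj₂ _ = false

private
  xor-comm : ∀ a b → a xor b ≡ b xor a
  xor-comm true  true  = refl
  xor-comm true  false = refl
  xor-comm false true  = refl
  xor-comm false false = refl

  xor-self : ∀ a → a xor a ≡ false
  xor-self true  = refl
  xor-self false = refl

K : (r d : ℕ) → Graph (r + d)
K r d = record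
  { adj    = λ i j → inLeft r i xor inLeft r j
  ; sym    = λ i j → xor-comm (inLeft r i) (inLeft r j)
  ; irrefl = λ i → xor-self (inLeft r i)
  }

-- S (a sequence of k vertices) is rare:
--   |N(S)| ≤ (2n)^(-2n) t_{K_{r,d}}(G)^(k/(rd)) N,
-- stated equivalently without reals by raising both (nonnegative) sides to
-- the power rd and clearing denominators (t = h / N^(r+d)):
--   |N(S)|^(rd) (2n)^(2n rd) N^((r+d)k) ≤ h^k N^(rd).
rare : {N : ℕ} → Graph N → (n r d k : ℕ) → Vec (Fin N) k → Bool
rare {N} G n r d k S =
  (nbhdSize G S ^ (r * d)) * ((2 * n) ^ (2 * n * (r * d))) * (N ^ ((r + d) * k))
    ≤ᵇ (homCount (K r d) G ^ k) * (N ^ (r * d))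

rareIn : {N : ℕ} → Graph N → (n r d k : ℕ) → Vec (Fin N) r → ℕ
rareIn G n r d k T = count (rare G n r d k) (seqs (nbhd G T) k)

bad : {N : ℕ} → Graph N → (n r d k : ℕ) → Vec (Fin N) r → Bool
bad G n r d k T = (nbhdSize G T ^ k) ≤ᵇ (2 * n * rareIn G n r d k T)

good : {N : ℕ} → Graph N → (n r d : ℕ) → Vec (Fin N) r → Bool
good G n r d T = all (λ k → not (d ≤ᵇ k) ∨ not (bad G n r d k T)) (upTo (suc n))

goodSum : {N : ℕ} → Graph N → (n r d : ℕ) → ℕ
goodSum {N} G n r d =
  sum (map (λ T → nbhdSize G T ^ d)
           (filter (λ T → Data.Bool.T? (good G n r d T)) (seqs (allFin N) r)))
  where import Data.Bool

{-# OPTIONS --safe #-}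
module Submission where

-- Every homomorphism K_{r,d} → G sends the right part into N(T) for its image T of the
-- left part, so h ≤ Σ_T |N(T)|^d, and it suffices that the T bad w.r.t. a fixed k ∈ [d, n] carry
-- at most h/(2n) of this sum. The power sums s_j = Σ_{T bad} |N(T)|^j are log-convex in j
-- (Cauchy–Schwarz), so Lyapunov's inequality gives s_d^k ≤ N^{r(k-d)} s_k^d. Badness bounds s_k by
-- 2n times the number of pairs (T, S) with S a rare sequence in N(T), that is by 2n Σ_{S rare} |N(S)|^r,
-- and the rarity threshold bounds this last sum; its factor (2n)^{-2n} absorbs the powers of 2n.

open import Defs
open import Data.Bool using (Bool; true; false; T; not; _∧_; _∨_; _xor_; T?)
open import Data.Bool.Properties using (T-∧; not-involutive)
open import Data.Empty using (⊥-elim)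
open import Data.Fin using (Fin; zero; suc; _↑ˡ_; _↑ʳ_)
open import Data.Fin.Properties using (splitAt-↑ˡ; splitAt-↑ʳ)
open import Data.List using (List; []; _∷_; map; concatMap; filter; length; allFin; upTo; applyUpTo; _++_)
open import Data.List.Membership.Propositional using (_∈_)
open import Data.List.Membership.Propositional.Properties using (∈-allFin)
open import Data.List.Properties using (length-tabulate)
open import Data.List.Relation.Unary.Any using (here; there)
open import Data.Nat using (ℕ; zero; suc; _+_; _*_; _^_; _≤_; _<_; _≤ᵇ_; z≤n; s≤s; NonZero; _≤?_)
open import Data.Nat.ListAction using (sum)
open import Data.Nat.Properties
open import Data.Nat.Tactic.RingSolver using (solve-∀)
open import Data.Product using (_,_; proj₁; proj₂)
open import Data.Sum using (inj₁; inj₂)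
open import Data.Unit using (tt)
open import Data.Vec using (Vec; []; _∷_; lookup) renaming (_++_ to _++ᵥ_)
open import Data.Vec.Properties using (lookup-++ˡ; lookup-++ʳ)
open import Function using (_∘_; Equivalence)
open import Relation.Binary.PropositionalEquality as ≡
  using (_≡_; refl; cong; cong₂; subst; subst₂; trans; module ≡-Reasoning)
open import Relation.Nullary using (yes; no; contradiction)

-- Finite sums and indicator weights

∑ : {A : Set} → List A → (A → ℕ) → ℕ
∑ []       f = 0
∑ (x ∷ xs) f = f x + ∑ xs f

infix 5 ∑
syntax ∑ xs (λ x → e) = ∑[ x ∈ xs ] e

infix 7.5 _when_

_when_ : ℕ → Bool → ℕ
n when true  = n
n when false = 0

when-∧ : ∀ a b n → (n when b) when a ≡ n when (a ∧ b)
when-∧ true  b n = refl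
when-∧ false b n = refl

when-split : ∀ b n → n ≡ n when b + n when not b
when-split true  n = ≡.sym (+-identityʳ n)
when-split false n = refl

when-≤ : ∀ b {x y} → (T b → x ≤ y) → x when b ≤ y
when-≤ true  h = h tt
when-≤ false h = z≤n

when-homogeneous : (f : ℕ → ℕ) → f 0 ≡ 0 → ∀ b x → f (x when b) ≡ f x when b
when-homogeneous f f0 true  x = refl
when-homogeneous f f0 false x = f0

when-mono-≤ : ∀ {a b} n → (T a → T b) → n when a ≤ n when b
when-mono-≤ {false}         n h = z≤n
when-mono-≤ {true}  {true}  n h = ≤-refl
when-mono-≤ {true}  {false} n h = ⊥-elim (h tt)

when-swap-≤ : ∀ a b {c} n → (T b → T c) → (n when a) when b ≤ (n when c) when a
when-swap-≤ a     false         n h = z≤n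
when-swap-≤ false true          n h = z≤n
when-swap-≤ true  true {true}  n h = ≤-refl
when-swap-≤ true  true {false} n h = ⊥-elim (h tt)

module _ {A : Set} where

  ∑-cong : (xs : List A) {f g : A → ℕ} → (∀ x → f x ≡ g x) → ∑ xs f ≡ ∑ xs g
  ∑-cong []       e = refl
  ∑-cong (x ∷ xs) e = cong₂ _+_ (e x) (∑-cong xs e)

  ∑-mono-≤ : (xs : List A) {f g : A → ℕ} → (∀ x → f x ≤ g x) → ∑ xs f ≤ ∑ xs g
  ∑-mono-≤ []       e = z≤n
  ∑-mono-≤ (x ∷ xs) e = +-mono-≤ (e x) (∑-mono-≤ xs e)

  ∑-zero : (xs : List A) → ∑ xs (λ _ → 0) ≡ 0
  ∑-zero []       = refl
  ∑-zero (x ∷ xs) = ∑-zero xs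

  ∑-distrib-+ : (xs : List A) (f g : A → ℕ) → ∑[ x ∈ xs ] (f x + g x) ≡ ∑ xs f + ∑ xs g
  ∑-distrib-+ []       f g = refl
  ∑-distrib-+ (x ∷ xs) f g = begin
    f x + g x + (∑[ y ∈ xs ] (f y + g y)) ≡⟨ cong (f x + g x +_) (∑-distrib-+ xs f g) ⟩
    f x + g x + (∑ xs f + ∑ xs g)       ≡⟨ +-assoc-middle (f x) (g x) (∑ xs f) (∑ xs g) ⟩
    f x + ∑ xs f + (g x + ∑ xs g)       ∎
    where
    open ≡-Reasoning
    +-assoc-middle : ∀ a b c d → a + b + (c + d) ≡ a + c + (b + d)
    +-assoc-middle = solve-∀

  *-distribˡ-∑ : (c : ℕ) (xs : List A) (f : A → ℕ) → c * ∑ xs f ≡ ∑[ x ∈ xs ] c * f x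
  *-distribˡ-∑ c []       f = *-zeroʳ c
  *-distribˡ-∑ c (x ∷ xs) f =
    trans (*-distribˡ-+ c (f x) (∑ xs f)) (cong (c * f x +_) (*-distribˡ-∑ c xs f))

  ∑-++ : (xs ys : List A) (f : A → ℕ) → ∑ (xs ++ ys) f ≡ ∑ xs f + ∑ ys f
  ∑-++ []       ys f = refl
  ∑-++ (x ∷ xs) ys f = trans (cong (f x +_) (∑-++ xs ys f)) (≡.sym (+-assoc (f x) (∑ xs f) (∑ ys f)))

  ∑-when : (xs : List A) (b : Bool) (f : A → ℕ) → ∑[ x ∈ xs ] (f x when b) ≡ ∑ xs f when b
  ∑-when xs true  f = refl
  ∑-when xs false f = ∑-zero xs

  ∑-filter : (xs : List A) (q : A → Bool) (f : A → ℕ) →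
    ∑ (filter (λ x → T? (q x)) xs) f ≡ ∑[ x ∈ xs ] (f x when q x)
  ∑-filter []       q f = refl
  ∑-filter (x ∷ xs) q f with q x
  ... | true  = cong (f x +_) (∑-filter xs q f)
  ... | false = ∑-filter xs q f

  ∑-const : (xs : List A) (c : ℕ) → ∑ xs (λ _ → c) ≡ length xs * c
  ∑-const []       c = refl
  ∑-const (x ∷ xs) c = cong (c +_) (∑-const xs c)

  ∑-bounded : (xs : List A) {f : A → ℕ} {c : ℕ} → (∀ x → f x ≤ c) → ∑ xs f ≤ length xs * c
  ∑-bounded xs {c = c} h = ≤-trans (∑-mono-≤ xs h) (≤-reflexive (∑-const xs c))

  length≡∑1 : (xs : List A) → length xs ≡ ∑ xs (λ _ → 1)
  length≡∑1 xs = trans (≡.sym (*-identityʳ (length xs))) (≡.sym (∑-const xs 1))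

  count≡∑ : (p : A → Bool) (xs : List A) → count p xs ≡ ∑[ x ∈ xs ] (1 when p x)
  count≡∑ p xs = trans (length≡∑1 (filter (λ x → T? (p x)) xs)) (∑-filter xs p (λ _ → 1))

  sum-map : (f : A → ℕ) (xs : List A) → sum (map f xs) ≡ ∑ xs f
  sum-map f []       = refl
  sum-map f (x ∷ xs) = cong (f x +_) (sum-map f xs)

  when-not-all-≤ : (p : A → Bool) (xs : List A) (n : ℕ) →
    n when not (all p xs) ≤ ∑[ x ∈ xs ] (n when not (p x))
  when-not-all-≤ p []       n = z≤n
  when-not-all-≤ p (x ∷ xs) n with p x
  ... | true  = when-not-all-≤ p xs n
  ... | false = m≤m+n n _

module _ {A B : Set} where

  ∑-map : (h : A → B) (xs : List A) (f : B → ℕ) → ∑ (map h xs) f ≡ ∑[ x ∈ xs ] f (h x)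
  ∑-map h []       f = refl
  ∑-map h (x ∷ xs) f = cong (f (h x) +_) (∑-map h xs f)

  ∑-concatMap : (h : A → List B) (xs : List A) (f : B → ℕ) →
    ∑ (concatMap h xs) f ≡ ∑[ x ∈ xs ] ∑ (h x) f
  ∑-concatMap h []       f = refl
  ∑-concatMap h (x ∷ xs) f =
    trans (∑-++ (h x) (concatMap h xs) f) (cong (∑ (h x) f +_) (∑-concatMap h xs f))

  ∑-comm : (xs : List A) (ys : List B) (g : A → B → ℕ) →
    ∑[ x ∈ xs ] ∑[ y ∈ ys ] g x y ≡ ∑[ y ∈ ys ] ∑[ x ∈ xs ] g x y
  ∑-comm []       ys g = ≡.sym (∑-zero ys)
  ∑-comm (x ∷ xs) ys g = trans (cong (∑ ys (g x) +_) (∑-comm xs ys g))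
    (≡.sym (∑-distrib-+ ys (g x) (λ y → ∑[ x ∈ xs ] g x y)))

∑-applyUpTo-≤ : (φ f : ℕ → ℕ) (c m : ℕ) → (∀ i → i < m → f (φ i) ≤ c) → ∑ (applyUpTo φ m) f ≤ m * c
∑-applyUpTo-≤ φ f c zero    h = z≤n
∑-applyUpTo-≤ φ f c (suc m) h =
  +-mono-≤ (h 0 (s≤s z≤n)) (∑-applyUpTo-≤ (φ ∘ suc) f c m (λ i i<m → h (suc i) (s≤s i<m)))

allᵥ : {A : Set} {k : ℕ} → (A → Bool) → Vec A k → Bool
allᵥ p []      = true
allᵥ p (x ∷ v) = p x ∧ allᵥ p v

module _ {A : Set} where

  ∑-seqs-suc : (xs : List A) (k : ℕ) (f : Vec A (suc k) → ℕ) →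
    ∑ (seqs xs (suc k)) f ≡ ∑[ x ∈ xs ] ∑[ v ∈ seqs xs k ] f (x ∷ v)
  ∑-seqs-suc xs k f = trans (∑-concatMap _ xs f) (∑-cong xs (λ x → ∑-map (x ∷_) (seqs xs k) f))

  length-seqs : (xs : List A) (k : ℕ) → length (seqs xs k) ≡ length xs ^ k
  length-seqs xs zero    = refl
  length-seqs xs (suc k) = begin
    length (seqs xs (suc k))                    ≡⟨ length≡∑1 (seqs xs (suc k)) ⟩
    ∑ (seqs xs (suc k)) (λ _ → 1)               ≡⟨ ∑-seqs-suc xs k _ ⟩
    ∑[ x ∈ xs ] ∑ (seqs xs k) (λ _ → 1)         ≡⟨ ∑-cong xs (λ _ → ≡.sym (length≡∑1 (seqs xs k))) ⟩
    ∑[ x ∈ xs ] length (seqs xs k)              ≡⟨ ∑-const xs _ ⟩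
    length xs * length (seqs xs k)              ≡⟨ cong (length xs *_) (length-seqs xs k) ⟩
    length xs * length xs ^ k                   ∎
    where open ≡-Reasoning

  ∑-seqs-filter : (xs : List A) (q : A → Bool) (k : ℕ) (f : Vec A k → ℕ) →
    ∑ (seqs (filter (λ x → T? (q x)) xs) k) f ≡ ∑[ v ∈ seqs xs k ] (f v when allᵥ q v)
  ∑-seqs-filter xs q zero    f = refl
  ∑-seqs-filter xs q (suc k) f = begin
    ∑ (seqs ys (suc k)) f
      ≡⟨ ∑-seqs-suc ys k f ⟩
    ∑[ x ∈ ys ] ∑[ v ∈ seqs ys k ] f (x ∷ v)
      ≡⟨ ∑-cong ys (λ x → ∑-seqs-filter xs q k (f ∘ (x ∷_))) ⟩
    ∑[ x ∈ ys ] ∑[ v ∈ seqs xs k ] (f (x ∷ v) when allᵥ q v)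
      ≡⟨ ∑-filter xs q _ ⟩
    ∑[ x ∈ xs ] ((∑[ v ∈ seqs xs k ] (f (x ∷ v) when allᵥ q v)) when q x)
      ≡⟨ ∑-cong xs (λ x → trans (≡.sym (∑-when (seqs xs k) (q x) (λ v → f (x ∷ v) when allᵥ q v)))
                                (∑-cong (seqs xs k) (λ v → when-∧ (q x) (allᵥ q v) _))) ⟩
    ∑[ x ∈ xs ] ∑[ v ∈ seqs xs k ] (f (x ∷ v) when allᵥ q (x ∷ v))
      ≡⟨ ≡.sym (∑-seqs-suc xs k _) ⟩
    ∑[ v ∈ seqs xs (suc k) ] (f v when allᵥ q v)
      ∎
    where
    open ≡-Reasoning
    ys = filter (λ x → T? (q x)) xs

  ∑-seqs-+ : (xs : List A) (m d : ℕ) (f : Vec A (m + d) → ℕ) →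
    ∑ (seqs xs (m + d)) f ≡ ∑[ u ∈ seqs xs m ] ∑[ v ∈ seqs xs d ] f (u ++ᵥ v)
  ∑-seqs-+ xs zero    d f = ≡.sym (+-identityʳ _)
  ∑-seqs-+ xs (suc m) d f = begin
    ∑ (seqs xs (suc m + d)) f
      ≡⟨ ∑-seqs-suc xs (m + d) f ⟩
    ∑[ x ∈ xs ] ∑[ w ∈ seqs xs (m + d) ] f (x ∷ w)
      ≡⟨ ∑-cong xs (λ x → ∑-seqs-+ xs m d (f ∘ (x ∷_))) ⟩
    ∑[ x ∈ xs ] ∑[ u ∈ seqs xs m ] ∑[ v ∈ seqs xs d ] f (x ∷ (u ++ᵥ v))
      ≡⟨ ≡.sym (∑-seqs-suc xs m _) ⟩
    ∑[ u ∈ seqs xs (suc m) ] ∑[ v ∈ seqs xs d ] f (u ++ᵥ v)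
      ∎
    where open ≡-Reasoning

length-seqs-allFin : (N k : ℕ) → length (seqs (allFin N) k) ≡ N ^ k
length-seqs-allFin N k = trans (length-seqs (allFin N) k) (cong (_^ k) (length-tabulate {n = N} (λ i → i)))

-- Common neighbourhoods and homomorphisms from K_{r,d}

module _ {A : Set} (p : A → Bool) where

  allᵥ-intro : {k : ℕ} (v : Vec A k) → (∀ j → T (p (lookup v j))) → T (allᵥ p v)
  allᵥ-intro []      h = tt
  allᵥ-intro (x ∷ v) h = Equivalence.from (T-∧ {p x} {allᵥ p v}) (h zero , allᵥ-intro v (h ∘ suc))

  allᵥ-elim : {k : ℕ} (v : Vec A k) → T (allᵥ p v) → ∀ j → T (p (lookup v j))
  allᵥ-elim (x ∷ v) t zero    = proj₁ (Equivalence.to (T-∧ {p x} {allᵥ p v}) t)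
  allᵥ-elim (x ∷ v) t (suc j) = allᵥ-elim v (proj₂ (Equivalence.to (T-∧ {p x} {allᵥ p v}) t)) j

  all-∈ : (xs : List A) {x : A} → T (all p xs) → x ∈ xs → T (p x)
  all-∈ (y ∷ xs) t (here refl) = proj₁ (Equivalence.to (T-∧ {p y} {all p xs}) t)
  all-∈ (y ∷ xs) t (there x∈) = all-∈ xs (proj₂ (Equivalence.to (T-∧ {p y} {all p xs}) t)) x∈

inLeft-↑ˡ : (r d : ℕ) (i : Fin r) → inLeft r {d} (i ↑ˡ d) ≡ true
inLeft-↑ˡ r d i rewrite splitAt-↑ˡ r i d = refl

inLeft-↑ʳ : (r d : ℕ) (j : Fin d) → inLeft r {d} (r ↑ʳ j) ≡ false
inLeft-↑ʳ r d j rewrite splitAt-↑ʳ r d j = refl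

K-adj-↑ˡ-↑ʳ : (r d : ℕ) (i : Fin r) (j : Fin d) → T (adj (K r d) (i ↑ˡ d) (r ↑ʳ j))
K-adj-↑ˡ-↑ʳ r d i j = subst T (≡.sym (cong₂ _xor_ (inLeft-↑ˡ r d i) (inLeft-↑ʳ r d j))) tt

module _ {N : ℕ} (G : Graph N) where

  inNbhd : {k r : ℕ} → Vec (Fin N) k → Vec (Fin N) r → Bool
  inNbhd U S = allᵥ (adjAll G S) U

  adjAll-intro : {r : ℕ} (S : Vec (Fin N) r) (v : Fin N) →
    (∀ i → T (adj G (lookup S i) v)) → T (adjAll G S v)
  adjAll-intro []      v h = tt
  adjAll-intro (s ∷ S) v h =
    Equivalence.from (T-∧ {adj G s v} {adjAll G S v}) (h zero , adjAll-intro S v (h ∘ suc))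

  adjAll-elim : {r : ℕ} (S : Vec (Fin N) r) (v : Fin N) →
    T (adjAll G S v) → ∀ i → T (adj G (lookup S i) v)
  adjAll-elim (s ∷ S) v t zero    = proj₁ (Equivalence.to (T-∧ {adj G s v} {adjAll G S v}) t)
  adjAll-elim (s ∷ S) v t (suc i) =
    adjAll-elim S v (proj₂ (Equivalence.to (T-∧ {adj G s v} {adjAll G S v}) t)) i

  inNbhd-intro : {k r : ℕ} (U : Vec (Fin N) k) (S : Vec (Fin N) r) →
    (∀ i j → T (adj G (lookup S i) (lookup U j))) → T (inNbhd U S)
  inNbhd-intro U S h = allᵥ-intro (adjAll G S) U (λ j → adjAll-intro S (lookup U j) (λ i → h i j))

  inNbhd-elim : {k r : ℕ} (U : Vec (Fin N) k) (S : Vec (Fin N) r) →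
    T (inNbhd U S) → ∀ i j → T (adj G (lookup S i) (lookup U j))
  inNbhd-elim U S t i j = adjAll-elim S (lookup U j) (allᵥ-elim (adjAll G S) U t j) i

  inNbhd-sym : {k r : ℕ} (U : Vec (Fin N) k) (S : Vec (Fin N) r) → T (inNbhd U S) → T (inNbhd S U)
  inNbhd-sym U S t = inNbhd-intro S U (λ j i → subst T (Graph.sym G _ _) (inNbhd-elim U S t i j))

  isHom⇒adj : {m : ℕ} (F : Graph m) (f : Vec (Fin N) m) → T (isHom F G f) →
    ∀ a b → T (adj F a b) → T (adj G (lookup f a) (lookup f b))
  isHom⇒adj {m} F f hom a b =
    modusPonens (adj F a b) (all-∈ _ (allFin m) (all-∈ _ (allFin m) hom (∈-allFin a)) (∈-allFin b))
    where
    modusPonens : ∀ x {y} → T (not x ∨ y) → T x → T y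
    modusPonens true t _ = t

  isHom-K⇒inNbhd : {r d : ℕ} (S : Vec (Fin N) r) (U : Vec (Fin N) d) →
    T (isHom (K r d) G (S ++ᵥ U)) → T (inNbhd U S)
  isHom-K⇒inNbhd {r} {d} S U hom = inNbhd-intro U S λ i j →
    subst₂ (λ a b → T (adj G a b)) (lookup-++ˡ S U i) (lookup-++ʳ S U j)
      (isHom⇒adj (K r d) (S ++ᵥ U) hom (i ↑ˡ d) (r ↑ʳ j) (K-adj-↑ˡ-↑ʳ r d i j))

  nbhdSize-^ : {r : ℕ} (S : Vec (Fin N) r) (k : ℕ) →
    nbhdSize G S ^ k ≡ ∑[ U ∈ seqs (allFin N) k ] (1 when inNbhd U S)
  nbhdSize-^ S k = begin
    nbhdSize G S ^ k               ≡⟨ ≡.sym (length-seqs (nbhd G S) k) ⟩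
    length (seqs (nbhd G S) k)     ≡⟨ length≡∑1 (seqs (nbhd G S) k) ⟩
    ∑ (seqs (nbhd G S) k) (λ _ → 1) ≡⟨ ∑-seqs-filter (allFin N) (adjAll G S) k _ ⟩
    ∑[ U ∈ seqs (allFin N) k ] (1 when inNbhd U S) ∎
    where open ≡-Reasoning

  homCount-K-≤ : (r d : ℕ) → homCount (K r d) G ≤ ∑[ S ∈ seqs (allFin N) r ] nbhdSize G S ^ d
  homCount-K-≤ r d = begin
    homCount (K r d) G
      ≡⟨ count≡∑ (isHom (K r d) G) (seqs V (r + d)) ⟩
    ∑[ f ∈ seqs V (r + d) ] (1 when isHom (K r d) G f)
      ≡⟨ ∑-seqs-+ V r d _ ⟩
    ∑[ S ∈ seqs V r ] ∑[ U ∈ seqs V d ] (1 when isHom (K r d) G (S ++ᵥ U))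
      ≤⟨ ∑-mono-≤ (seqs V r) (λ S → ∑-mono-≤ (seqs V d) (λ U →
           when-mono-≤ 1 (isHom-K⇒inNbhd S U))) ⟩
    ∑[ S ∈ seqs V r ] ∑[ U ∈ seqs V d ] (1 when inNbhd U S)
      ≡⟨ ∑-cong (seqs V r) (λ S → ≡.sym (nbhdSize-^ S d)) ⟩
    ∑[ S ∈ seqs V r ] nbhdSize G S ^ d
      ∎
    where
    open ≤-Reasoning
    V = allFin N

  ∑-rareIn-≤ : (n r d k : ℕ) →
    ∑[ S ∈ seqs (allFin N) r ] rareIn G n r d k S
      ≤ ∑[ U ∈ seqs (allFin N) k ] (nbhdSize G U ^ r when rare G n r d k U)
  ∑-rareIn-≤ n r d k = begin
    ∑[ S ∈ Ss ] rareIn G n r d k S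
      ≡⟨ ∑-cong Ss (λ S → trans (count≡∑ (rare G n r d k) (seqs (nbhd G S) k))
                                (∑-seqs-filter (allFin N) (adjAll G S) k _)) ⟩
    ∑[ S ∈ Ss ] ∑[ U ∈ Us ] ((1 when rare G n r d k U) when inNbhd U S)
      ≡⟨ ∑-comm Ss Us _ ⟩
    ∑[ U ∈ Us ] ∑[ S ∈ Ss ] ((1 when rare G n r d k U) when inNbhd U S)
      ≤⟨ ∑-mono-≤ Us (λ U → ∑-mono-≤ Ss (λ S →
           when-swap-≤ (rare G n r d k U) (inNbhd U S) 1 (inNbhd-sym U S))) ⟩
    ∑[ U ∈ Us ] ∑[ S ∈ Ss ] ((1 when inNbhd S U) when rare G n r d k U)
      ≡⟨ ∑-cong Us (λ U → trans (∑-when Ss (rare G n r d k U) _)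
                                (cong (_when rare G n r d k U) (≡.sym (nbhdSize-^ U r)))) ⟩
    ∑[ U ∈ Us ] (nbhdSize G U ^ r when rare G n r d k U)
      ∎
    where
    open ≤-Reasoning
    Ss = seqs (allFin N) r
    Us = seqs (allFin N) k

2*m*[m+o]≤m*m+[m+o]*[m+o] : ∀ m o → 2 * m * (m + o) ≤ m * m + (m + o) * (m + o)
2*m*[m+o]≤m*m+[m+o]*[m+o] m o = subst (2 * m * (m + o) ≤_) (≡.sym (square-gap m o)) (m≤m+n _ (o * o))
  where
  square-gap : ∀ m o → m * m + (m + o) * (m + o) ≡ 2 * m * (m + o) + o * o
  square-gap = solve-∀

2*m*n≤m*m+n*n : ∀ m n → 2 * m * n ≤ m * m + n * n
2*m*n≤m*m+n*n m n with ≤-total m n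
... | inj₁ m≤n with m≤n⇒∃[o]m+o≡n m≤n
...   | o , refl = 2*m*[m+o]≤m*m+[m+o]*[m+o] m o
2*m*n≤m*m+n*n m n | inj₂ n≤m with m≤n⇒∃[o]m+o≡n n≤m
...   | o , refl = subst₂ _≤_ (swap (n + o) n) (+-comm (n * n) _) (2*m*[m+o]≤m*m+[m+o]*[m+o] n o)
  where
  swap : ∀ m n → 2 * n * m ≡ 2 * m * n
  swap = solve-∀

^-distribʳ-* : ∀ m n o → (m * n) ^ o ≡ m ^ o * n ^ o
^-distribʳ-* m n zero    = refl
^-distribʳ-* m n (suc o) = trans (cong (m * n *_) (^-distribʳ-* m n o)) (interchange m n (m ^ o) (n ^ o))
  where
  interchange : ∀ a b c d → a * b * (c * d) ≡ a * c * (b * d)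
  interchange = solve-∀

^-*-comm : ∀ m n o → (m ^ n) ^ o ≡ (m ^ o) ^ n
^-*-comm m n o = trans (^-*-assoc m n o) (trans (cong (m ^_) (*-comm n o)) (≡.sym (^-*-assoc m o n)))

^-cancelʳ-≤ : ∀ k .{{_ : NonZero k}} {m n} → m ^ k ≤ n ^ k → m ≤ n
^-cancelʳ-≤ k {m} {n} h with m ≤? n
... | yes m≤n = m≤n
... | no  m≰n = contradiction h (<⇒≱ (^-monoˡ-< k (≰⇒> m≰n)))

^-volume : ∀ N r d m → (N ^ r) ^ m * (N ^ (d + m)) ^ d * N ^ (r * d) ≡ N ^ ((r + d) * (d + m))
^-volume N r d m = begin
  (N ^ r) ^ m * (N ^ (d + m)) ^ d * N ^ (r * d)
    ≡⟨ cong₂ (λ a b → a * b * N ^ (r * d)) (^-*-assoc N r m) (^-*-assoc N (d + m) d) ⟩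
  N ^ (r * m) * N ^ ((d + m) * d) * N ^ (r * d)
    ≡⟨ cong (_* N ^ (r * d)) (≡.sym (^-distribˡ-+-* N (r * m) ((d + m) * d))) ⟩
  N ^ (r * m + (d + m) * d) * N ^ (r * d)
    ≡⟨ ≡.sym (^-distribˡ-+-* N (r * m + (d + m) * d) (r * d)) ⟩
  N ^ (r * m + (d + m) * d + r * d)
    ≡⟨ cong (N ^_) (exponent-identity r d m) ⟩
  N ^ ((r + d) * (d + m))
    ∎
  where
  open ≡-Reasoning
  exponent-identity : ∀ r d m → r * m + (d + m) * d + r * d ≡ (r + d) * (d + m)
  exponent-identity = solve-∀

x≤y+z∧2z≤x⇒x≤2y : ∀ {x} y z → x ≤ y + z → 2 * z ≤ x → x ≤ 2 * y
x≤y+z∧2z≤x⇒x≤2y {x} y z x≤y+z 2z≤x = +-cancelʳ-≤ x x (2 * y) (begin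
  x + x               ≤⟨ +-mono-≤ x≤y+z x≤y+z ⟩
  y + z + (y + z)     ≡⟨ double-sum y z ⟩
  2 * y + 2 * z       ≤⟨ +-monoʳ-≤ (2 * y) 2z≤x ⟩
  2 * y + x           ∎)
  where
  open ≤-Reasoning
  double-sum : ∀ y z → y + z + (y + z) ≡ 2 * y + 2 * z
  double-sum = solve-∀

-- Cauchy–Schwarz, log-convexity and power sums

module _ {A : Set} (w x : A → ℕ) where

  weighted-Cauchy-Schwarz : (xs : List A) →
    (∑[ a ∈ xs ] w a * x a) * (∑[ a ∈ xs ] w a * x a) ≤ ∑ xs w * (∑[ a ∈ xs ] w a * x a * x a)
  weighted-Cauchy-Schwarz []       = z≤n
  weighted-Cauchy-Schwarz (y ∷ ys) = subst₂ _≤_ (≡.sym (expandˡ (w y * x y) M)) (≡.sym (expandʳ (w y) W (x y) Q))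
    (+-mono-≤ (+-monoʳ-≤ (w y * x y * (w y * x y)) cross) (weighted-Cauchy-Schwarz ys))
    where
    M = ∑[ a ∈ ys ] w a * x a
    W = ∑ ys w
    Q = ∑[ a ∈ ys ] w a * x a * x a
    term : ∀ a → 2 * (w y * x y) * (w a * x a) ≤ w y * (w a * x a * x a) + w y * x y * x y * w a
    term a = subst₂ _≤_ (regroupˡ (w y) (x y) (w a) (x a)) (regroupʳ (w y) (x y) (w a) (x a))
      (*-monoʳ-≤ (w y * w a) (2*m*n≤m*m+n*n (x y) (x a)))
      where
      regroupˡ : ∀ v s u t → v * u * (2 * s * t) ≡ 2 * (v * s) * (u * t)
      regroupˡ = solve-∀
      regroupʳ : ∀ v s u t → v * u * (s * s + t * t) ≡ v * (u * t * t) + v * s * s * u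
      regroupʳ = solve-∀
    cross : 2 * (w y * x y) * M ≤ w y * Q + w y * x y * x y * W
    cross = begin
      2 * (w y * x y) * M
        ≡⟨ *-distribˡ-∑ (2 * (w y * x y)) ys _ ⟩
      ∑[ a ∈ ys ] 2 * (w y * x y) * (w a * x a)
        ≤⟨ ∑-mono-≤ ys term ⟩
      ∑[ a ∈ ys ] (w y * (w a * x a * x a) + w y * x y * x y * w a)
        ≡⟨ ∑-distrib-+ ys _ _ ⟩
      (∑[ a ∈ ys ] w y * (w a * x a * x a)) + (∑[ a ∈ ys ] w y * x y * x y * w a)
        ≡⟨ ≡.sym (cong₂ _+_ (*-distribˡ-∑ (w y) ys _) (*-distribˡ-∑ (w y * x y * x y) ys w)) ⟩
      w y * Q + w y * x y * x y * W
        ∎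
      where open ≤-Reasoning
    expandˡ : ∀ p M → (p + M) * (p + M) ≡ p * p + 2 * p * M + M * M
    expandˡ = solve-∀
    expandʳ : ∀ v W s Q → (v + W) * (v * s * s + Q) ≡ v * s * (v * s) + (v * Q + v * s * s * W) + W * Q
    expandʳ = solve-∀

LogConvex : (ℕ → ℕ) → Set
LogConvex a = ∀ j → a (suc j) * a (suc j) ≤ a j * a (suc (suc j))

module _ {a : ℕ → ℕ} (convex : LogConvex a) where

  lyapunov-step : ∀ j → a j ^ suc j ≤ a 0 * a (suc j) ^ j
  lyapunov-step zero = ≤-refl
  lyapunov-step (suc j) with a (suc j) in eq
  ... | zero  = z≤n
  ... | suc t = *-cancelʳ-≤ _ _ (b ^ j) {{m^n≢0 b j}} (begin
    b ^ suc (suc j) * b ^ j        ≡⟨ square-split ⟩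
    (b * b) ^ suc j                ≤⟨ ^-monoˡ-≤ (suc j) (subst (λ z → z * z ≤ a j * c) eq (convex j)) ⟩
    (a j * c) ^ suc j              ≡⟨ ^-distribʳ-* (a j) c (suc j) ⟩
    a j ^ suc j * c ^ suc j        ≤⟨ *-monoˡ-≤ _ (subst (λ z → a j ^ suc j ≤ a 0 * z ^ j) eq (lyapunov-step j)) ⟩
    a 0 * b ^ j * c ^ suc j        ≡⟨ *-right-comm (a 0) (b ^ j) (c ^ suc j) ⟩
    a 0 * c ^ suc j * b ^ j        ∎)
    where
    open ≤-Reasoning
    b = suc t
    c = a (suc (suc j))
    square-split : b ^ suc (suc j) * b ^ j ≡ (b * b) ^ suc j
    square-split = trans (regroup b (b ^ j)) (≡.sym (^-distribʳ-* b b (suc j)))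
      where
      regroup : ∀ b p → b * (b * p) * p ≡ b * p * (b * p)
      regroup = solve-∀
    *-right-comm : ∀ x y z → x * y * z ≡ x * z * y
    *-right-comm = solve-∀

  lyapunov : ∀ e m → a e ^ (e + m) ≤ a 0 ^ m * a (e + m) ^ e
  lyapunov zero    m = ≤-reflexive (≡.sym (*-identityʳ (a 0 ^ m)))
  lyapunov (suc d) zero rewrite +-identityʳ d = ≤-reflexive (≡.sym (*-identityˡ (a (suc d) ^ suc d)))
  lyapunov (suc d) (suc m) rewrite +-suc d m = ^-cancelʳ-≤ k (begin
    (a e ^ suc k) ^ k                   ≡⟨ ^-*-comm (a e) (suc k) k ⟩
    (a e ^ k) ^ suc k                   ≤⟨ ^-monoˡ-≤ (suc k) (lyapunov e m) ⟩
    (z ^ m * a k ^ e) ^ suc k           ≡⟨ ^-distribʳ-* (z ^ m) (a k ^ e) (suc k) ⟩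
    (z ^ m) ^ suc k * (a k ^ e) ^ suc k ≡⟨ cong ((z ^ m) ^ suc k *_) (^-*-comm (a k) e (suc k)) ⟩
    (z ^ m) ^ suc k * (a k ^ suc k) ^ e ≤⟨ *-monoʳ-≤ ((z ^ m) ^ suc k) (^-monoˡ-≤ e (lyapunov-step k)) ⟩
    (z ^ m) ^ suc k * (z * c ^ k) ^ e   ≡⟨ cong ((z ^ m) ^ suc k *_) (^-distribʳ-* z (c ^ k) e) ⟩
    (z ^ m) ^ suc k * (z ^ e * (c ^ k) ^ e)
      ≡⟨ ≡.sym (*-assoc ((z ^ m) ^ suc k) (z ^ e) _) ⟩
    (z ^ m) ^ suc k * z ^ e * (c ^ k) ^ e
      ≡⟨ cong₂ _*_ exponents (^-*-comm c k e) ⟩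
    (z ^ suc m) ^ k * (c ^ e) ^ k       ≡⟨ ≡.sym (^-distribʳ-* (z ^ suc m) (c ^ e) k) ⟩
    (z ^ suc m * c ^ e) ^ k             ∎)
    where
    open ≤-Reasoning
    e = suc d
    k = e + m
    z = a 0
    c = a (suc k)
    exponents : (z ^ m) ^ suc k * z ^ e ≡ (z ^ suc m) ^ k
    exponents = begin-equality
      (z ^ m) ^ suc k * z ^ e  ≡⟨ cong (_* z ^ e) (^-*-assoc z m (suc k)) ⟩
      z ^ (m * suc k) * z ^ e  ≡⟨ ≡.sym (^-distribˡ-+-* z (m * suc k) e) ⟩
      z ^ (m * suc k + e)      ≡⟨ cong (z ^_) (exponent-identity d m) ⟩
      z ^ (suc m * k)          ≡⟨ ≡.sym (^-*-assoc z (suc m) k) ⟩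
      (z ^ suc m) ^ k          ∎
      where
      exponent-identity : ∀ d m → m * suc (suc d + m) + suc d ≡ suc m * (suc d + m)
      exponent-identity = solve-∀

powerSum : {A : Set} → (A → ℕ) → List A → ℕ → ℕ
powerSum g xs j = ∑[ x ∈ xs ] g x ^ j

module _ {A : Set} (g : A → ℕ) (xs : List A) where

  powerSum-zero : powerSum g xs 0 ≡ length xs
  powerSum-zero = ≡.sym (length≡∑1 xs)

  powerSum-logConvex : LogConvex (powerSum g xs)
  powerSum-logConvex j = subst₂ (λ s t → s * s ≤ powerSum g xs j * t)
    (∑-cong xs (λ x → *-comm (g x ^ j) (g x)))
    (∑-cong xs (λ x → shift (g x) (g x ^ j)))
    (weighted-Cauchy-Schwarz (λ x → g x ^ j) g xs)
    where
    shift : ∀ y p → p * y * y ≡ y * (y * p)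
    shift = solve-∀

  power-mean : ∀ m → ∑ xs g ^ suc m ≤ length xs ^ m * powerSum g xs (suc m)
  power-mean m = subst₂ (λ s t → s ^ suc m ≤ t ^ m * powerSum g xs (suc m))
    (∑-cong xs (λ x → *-identityʳ (g x))) powerSum-zero
    (≤-trans (lyapunov {powerSum g xs} powerSum-logConvex 1 m) (≤-reflexive (cong (powerSum g xs 0 ^ m *_) (*-identityʳ _))))

-- Bad and rare sequences

module _ {N : ℕ} (G : Graph N) (n r d : ℕ) where

  badNbhdSize : (k : ℕ) → Vec (Fin N) r → ℕ
  badNbhdSize k S = nbhdSize G S when bad G n r d k S

  rareWeight : (k : ℕ) → Vec (Fin N) k → ℕ
  rareWeight k U = nbhdSize G U ^ r when rare G n r d k U

  powerSum-badNbhdSize-≤ : (k : ℕ) →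
    powerSum (badNbhdSize (suc k)) (seqs (allFin N) r) (suc k)
      ≤ 2 * n * ∑ (seqs (allFin N) (suc k)) (rareWeight (suc k))
  powerSum-badNbhdSize-≤ k = begin
    powerSum (badNbhdSize (suc k)) Ss (suc k)
      ≤⟨ ∑-mono-≤ Ss (λ S → subst (_≤ 2 * n * rareIn G n r d (suc k) S)
           (≡.sym (when-homogeneous (_^ suc k) refl (bad G n r d (suc k) S) (nbhdSize G S)))
           (when-≤ (bad G n r d (suc k) S) (≤ᵇ⇒≤ _ _))) ⟩
    ∑[ S ∈ Ss ] 2 * n * rareIn G n r d (suc k) S
      ≡⟨ ≡.sym (*-distribˡ-∑ (2 * n) Ss _) ⟩
    2 * n * (∑[ S ∈ Ss ] rareIn G n r d (suc k) S)
      ≤⟨ *-monoʳ-≤ (2 * n) (∑-rareIn-≤ G n r d (suc k)) ⟩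
    2 * n * ∑ (seqs (allFin N) (suc k)) (rareWeight (suc k))
      ∎
    where
    open ≤-Reasoning
    Ss = seqs (allFin N) r

∑-rareWeight-≤ : {N : ℕ} (G : Graph N) (n r d k : ℕ) →
  (2 * n) ^ (2 * n * (r * suc d)) * N ^ ((r + suc d) * k) * ∑ (seqs (allFin N) k) (rareWeight G n r (suc d) k) ^ suc d
    ≤ (N ^ k) ^ suc d * (homCount (K r (suc d)) G ^ k * N ^ (r * suc d))
∑-rareWeight-≤ {N} G n r d k = begin
  CE * ∑ Us φ ^ suc d
    ≤⟨ *-monoʳ-≤ CE (power-mean φ Us d) ⟩
  CE * (length Us ^ d * powerSum φ Us (suc d))
    ≡⟨ trans (*-left-comm CE (length Us ^ d) _) (cong (length Us ^ d *_) (*-distribˡ-∑ CE Us _)) ⟩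
  length Us ^ d * (∑[ U ∈ Us ] CE * φ U ^ suc d)
    ≤⟨ *-monoʳ-≤ (length Us ^ d) (∑-bounded Us rare-term) ⟩
  length Us ^ d * (length Us * H)
    ≡⟨ *-left-comm (length Us ^ d) (length Us) H ⟩
  length Us * (length Us ^ d * H)
    ≡⟨ ≡.sym (*-assoc (length Us) (length Us ^ d) H) ⟩
  length Us ^ suc d * H
    ≡⟨ cong (λ l → l ^ suc d * H) (length-seqs-allFin N k) ⟩
  (N ^ k) ^ suc d * H
    ∎
  where
  open ≤-Reasoning
  Us = seqs (allFin N) k
  φ = rareWeight G n r (suc d) k
  C = (2 * n) ^ (2 * n * (r * suc d))
  E = N ^ ((r + suc d) * k)
  CE = C * E
  H = homCount (K r (suc d)) G ^ k * N ^ (r * suc d)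
  *-left-comm : ∀ x y z → x * (y * z) ≡ y * (x * z)
  *-left-comm = solve-∀
  rare-term : ∀ U → CE * φ U ^ suc d ≤ H
  rare-term U = subst (_≤ H)
    (≡.sym (when-homogeneous (λ x → CE * x ^ suc d) (*-zeroʳ CE) (rare G n r (suc d) k U) _))
    (when-≤ (rare G n r (suc d) k U) (≤-trans (≤-reflexive rearrange) ∘ ≤ᵇ⇒≤ _ _))
    where
    rearrange : CE * (nbhdSize G U ^ r) ^ suc d ≡ nbhdSize G U ^ (r * suc d) * C * E
    rearrange = trans (cong (CE *_) (^-*-assoc (nbhdSize G U) r (suc d))) (rotate C E _)
      where
      rotate : ∀ c e x → c * e * x ≡ x * c * e
      rotate = solve-∀

-- Proved after raising to the k-th power and scaling by the denominator C * E of the rarity threshold.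
bad-mass-≤ : {N : ℕ} (G : Graph N) (n r d k : ℕ) → 1 ≤ r → 1 ≤ d → d ≤ k → k ≤ n →
  2 * n * powerSum (badNbhdSize G n r d k) (seqs (allFin N) r) d ≤ homCount (K r d) G
bad-mass-≤ {zero} G n r d k (s≤s z≤n) _ _ _ = subst (_≤ homCount (K r d) G) (≡.sym (*-zeroʳ (2 * n))) z≤n
bad-mass-≤ {suc _} G zero r d k _ (s≤s z≤n) d≤k k≤n = contradiction (≤-trans d≤k k≤n) λ ()
bad-mass-≤ {N@(suc _)} G n@(suc _) r@(suc _) d@(suc d') k (s≤s z≤n) _ d≤k k≤n
  with m≤n⇒∃[o]m+o≡n d≤k
... | m , refl = ^-cancelʳ-≤ k (*-cancelˡ-≤ CE {{m*n≢0 C E {{m^n≢0 nn (2 * n * (r * d))}} {{m^n≢0 N ((r + d) * k)}}}} (begin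
  CE * (nn * A) ^ k
    ≡⟨ cong (CE *_) (^-distribʳ-* nn A k) ⟩
  CE * (nn ^ k * A ^ k)
    ≤⟨ *-monoʳ-≤ CE (*-monoʳ-≤ (nn ^ k) (≤-trans lyap (*-monoʳ-≤ (L ^ m) (^-monoˡ-≤ d P≤)))) ⟩
  CE * (nn ^ k * (L ^ m * (nn * Q) ^ d))
    ≡⟨ cong (λ z → CE * (nn ^ k * (L ^ m * z))) (^-distribʳ-* nn Q d) ⟩
  CE * (nn ^ k * (L ^ m * (nn ^ d * Q ^ d)))
    ≡⟨ regroup₁ CE (nn ^ k) (L ^ m) (nn ^ d) (Q ^ d) ⟩
  nn ^ k * nn ^ d * L ^ m * (CE * Q ^ d)
    ≤⟨ *-monoʳ-≤ (nn ^ k * nn ^ d * L ^ m) (∑-rareWeight-≤ G n r d' k) ⟩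
  nn ^ k * nn ^ d * L ^ m * ((N ^ k) ^ d * (h ^ k * N ^ (r * d)))
    ≡⟨ regroup₂ (nn ^ k * nn ^ d) (L ^ m) ((N ^ k) ^ d) (h ^ k) (N ^ (r * d)) ⟩
  nn ^ k * nn ^ d * (L ^ m * (N ^ k) ^ d * N ^ (r * d)) * h ^ k
    ≡⟨ cong₂ (λ a b → a * b * h ^ k) (≡.sym (^-distribˡ-+-* nn k d)) (^-volume N r d m) ⟩
  nn ^ (k + d) * E * h ^ k
    ≤⟨ *-monoˡ-≤ (h ^ k) (*-monoˡ-≤ E large) ⟩
  CE * h ^ k
    ∎))
  where
  open ≤-Reasoning
  nn = 2 * n
  h  = homCount (K r d) G
  C  = nn ^ (2 * n * (r * d))
  E  = N ^ ((r + d) * k)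
  CE = C * E
  Ss = seqs (allFin N) r
  g  = badNbhdSize G n r d k
  L  = N ^ r
  A  = powerSum g Ss d
  Q  = ∑ (seqs (allFin N) k) (rareWeight G n r d k)
  lyap : A ^ k ≤ L ^ m * powerSum g Ss k ^ d
  lyap = subst (λ l → A ^ k ≤ l ^ m * powerSum g Ss k ^ d)
    (trans (powerSum-zero g Ss) (length-seqs-allFin N r)) (lyapunov {powerSum g Ss} (powerSum-logConvex g Ss) d m)
  P≤ : powerSum g Ss k ≤ nn * Q
  P≤ = powerSum-badNbhdSize-≤ G n r d (d' + m)
  large : nn ^ (k + d) ≤ C
  large = ^-monoʳ-≤ nn (begin
    k + d     ≤⟨ +-mono-≤ k≤n (≤-trans d≤k k≤n) ⟩
    n + n     ≡⟨ cong (n +_) (≡.sym (+-identityʳ n)) ⟩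
    2 * n     ≤⟨ m≤m*n (2 * n) (r * d) ⟩
    2 * n * (r * d) ∎)
  regroup₁ : ∀ c a l b q → c * (a * (l * (b * q))) ≡ a * b * l * (c * q)
  regroup₁ = solve-∀
  regroup₂ : ∀ a l x y z → a * l * (x * (y * z)) ≡ a * (l * x * z) * y
  regroup₂ = solve-∀

not-good-mass-≤ : {N : ℕ} (G : Graph N) (n r d : ℕ) → 1 ≤ r → 1 ≤ d → d ≤ n →
  2 * (∑[ S ∈ seqs (allFin N) r ] (nbhdSize G S ^ d when not (good G n r d S))) ≤ homCount (K r d) G
not-good-mass-≤ {N} G n@(suc _) r d@(suc _) 1≤r 1≤d d≤n = *-cancelˡ-≤ n (begin
  n * (2 * (∑[ S ∈ Ss ] (a S when not (good G n r d S))))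
    ≡⟨ double n (∑[ S ∈ Ss ] (a S when not (good G n r d S))) ⟩
  2 * n * (∑[ S ∈ Ss ] (a S when not (good G n r d S)))
    ≤⟨ *-monoʳ-≤ (2 * n) (∑-mono-≤ Ss (λ S → when-not-all-≤ (goodAt S) (upTo (suc n)) (a S))) ⟩
  2 * n * (∑[ S ∈ Ss ] ∑[ k ∈ upTo (suc n) ] (a S when not (goodAt S k)))
    ≡⟨ cong (2 * n *_) (∑-comm Ss (upTo (suc n)) _) ⟩
  2 * n * (∑[ k ∈ upTo (suc n) ] F k)
    ≡⟨ *-distribˡ-∑ (2 * n) (upTo (suc n)) F ⟩
  2 * n * F 0 + rest
    -- k = 0 contributes nothing, since d ≤ᵇ 0 is false for d ≥ 1
    ≡⟨ cong (λ z → 2 * n * z + rest) (∑-zero Ss) ⟩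
  2 * n * 0 + rest
    ≡⟨ cong (_+ rest) (*-zeroʳ (2 * n)) ⟩
  rest
    ≤⟨ ∑-applyUpTo-≤ suc (λ k → 2 * n * F k) _ n F-bound ⟩
  n * homCount (K r d) G
    ∎)
  where
  open ≤-Reasoning
  Ss = seqs (allFin N) r
  a : Vec (Fin N) r → ℕ
  a S = nbhdSize G S ^ d
  goodAt : Vec (Fin N) r → ℕ → Bool
  goodAt S k = not (d ≤ᵇ k) ∨ not (bad G n r d k S)
  F : ℕ → ℕ
  F k = ∑[ S ∈ Ss ] (a S when not (goodAt S k))
  rest : ℕ
  rest = ∑[ k ∈ applyUpTo suc n ] 2 * n * F k
  double : ∀ x s → x * (2 * s) ≡ 2 * x * s
  double = solve-∀
  F-bound : ∀ i → i < n → 2 * n * F (suc i) ≤ homCount (K r d) G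
  F-bound i i<n with d ≤ᵇ suc i in d≤ᵇ
  ... | false = subst (_≤ homCount (K r d) G) (≡.sym (trans (cong (2 * n *_) (∑-zero Ss)) (*-zeroʳ (2 * n)))) z≤n
  ... | true  = subst (λ z → 2 * n * z ≤ homCount (K r d) G) (∑-cong Ss bad-term)
    (bad-mass-≤ G n r d (suc i) 1≤r 1≤d (≤ᵇ⇒≤ d (suc i) (subst T (≡.sym d≤ᵇ) tt)) i<n)
    where
    bad-term : ∀ S → badNbhdSize G n r d (suc i) S ^ d ≡ a S when not (not (bad G n r d (suc i) S))
    bad-term S = trans (when-homogeneous (_^ d) refl (bad G n r d (suc i) S) (nbhdSize G S))
                       (cong (a S when_) (≡.sym (not-involutive _)))

lemma2p1 : (N : ℕ) (G : Graph N) (d n r : ℕ) →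
    1 ≤ d → 1 ≤ n → 1 ≤ r → d ≤ n →
    homCount (K r d) G ≤ 2 * goodSum G n r d
lemma2p1 N G d n r 1≤d _ 1≤r d≤n =
  subst (λ s → homCount (K r d) G ≤ 2 * s) (≡.sym goodSum≡)
    (x≤y+z∧2z≤x⇒x≤2y goodMass notGoodMass (≤-trans (homCount-K-≤ G r d) (≤-reflexive split))
                     (not-good-mass-≤ G n r d 1≤r 1≤d d≤n))
  where
  Ss = seqs (allFin N) r
  a : Vec (Fin N) r → ℕ
  a S = nbhdSize G S ^ d
  goodMass notGoodMass : ℕ
  goodMass = ∑[ S ∈ Ss ] (a S when good G n r d S)
  notGoodMass = ∑[ S ∈ Ss ] (a S when not (good G n r d S))
  split : ∑ Ss a ≡ goodMass + notGoodMass
  split = trans (∑-cong Ss (λ S → when-split (good G n r d S) (a S))) (∑-distrib-+ Ss _ _)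
  goodSum≡ : goodSum G n r d ≡ goodMass
  goodSum≡ = trans (sum-map a (filter (λ S → T? (good G n r d S)) Ss)) (∑-filter Ss (good G n r d) a)
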